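{- For $k\ge 1$ and $n\ge 0$ let $a_{n,k}$ be the number of standard paths of length $n$ whose final composition has exactly $k$ parts, and let $L_k(t)=\sum_{n\ge 0}a_{n,k}t^n$. Then \[ L_k(t)=\frac{t^k\,\tilde L_k(t)}{\prod_{i=1}^k(1-it)}, \] where $\tilde L_k(t)$ is a polynomial of degree $k-1$ with $\tilde L_k(1)=2^{k-1}$.
   Context: A composition is a finite sequence $P=(p_1,\dots,p_k)$ of positive integers (its parts); $k$ is the number of parts, the empty composition $()$ has $0$ parts, and the weight of $P$ is $p_1+\cdots+p_k$. $Q$ covers $P=(p_1,\dots,p_k)$ if $Q$ is one of $(1,p_1,\dots,p_k)$, $(p_1,\dots,p_k,1)$, or $(p_1,\dots,p_i+1,\dots,p_k)$ for some $1\le i\le k$. A standard path of length $n$ is a sequence $(P_0,P_1,\dots,P_n)$ of compositions with $P_i$ of weight $i$ and $P_{i+1}$ covering $P_i$ for each $i$; its final composition is $P_n$. Standard paths are distinct iff they differ as sequences of compositions. -}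

module Defs where

open import Data.Nat as ℕ using (ℕ; zero; suc)
import Data.Nat.Properties as ℕP
open import Data.Integer as ℤ using (ℤ; +_; 0ℤ; 1ℤ)
open import Data.List using (List; []; _∷_; _++_; [_]; length; concatMap; map; filter; replicate; upTo; foldr)
open import Data.List.Properties using (≡-dec)
open import Data.Vec as Vec using (Vec; head)
open import Data.Fin using (Fin)
import Data.Fin.Properties as FinP
open import Data.Product using (Σ; ∃; _×_; _,_)
open import Data.Empty using (⊥)
open import Data.Sum using (_⊎_)
open import Relation.Binary.PropositionalEquality using (_≡_)
open import Relation.Nullary using (Dec)
open import Relation.Nullary.Decidable using (_⊎-dec_)

-- Compositions are represented as lists of natural numbers (parts).
-- All compositions used below are generated by `comps`, whose parts are
-- positive by construction.

Composition : Set
Composition = List ℕ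

weight : Composition → ℕ
weight = foldr ℕ._+_ 0

-- comps w : all compositions of weight w, each exactly once.
-- Compositions of w+1 arise uniquely from those of w either by
-- prepending a part 1 or by increasing the first part.
comps : ℕ → List Composition
comps zero    = [] ∷ []
comps (suc n) = concatMap step (comps n)
  where
  step : Composition → List Composition
  step []       = (1 ∷ []) ∷ []
  step (p ∷ ps) = (1 ∷ p ∷ ps) ∷ (suc p ∷ ps) ∷ []

incAt : (P : Composition) → Fin (length P) → Composition
incAt (p ∷ ps) Fin.zero    = suc p ∷ ps
incAt (p ∷ ps) (Fin.suc i) = p ∷ incAt ps i

Covers : Composition → Composition → Set
Covers Q P = (Q ≡ 1 ∷ P) ⊎ (Q ≡ P ++ [ 1 ]) ⊎ (∃ λ (i : Fin (length P)) → Q ≡ incAt P i)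

_≟C_ : (P Q : Composition) → Dec (P ≡ Q)
_≟C_ = ≡-dec ℕP._≟_

covers? : (Q P : Composition) → Dec (Covers Q P)
covers? Q P = (Q ≟C (1 ∷ P)) ⊎-dec ((Q ≟C (P ++ [ 1 ])) ⊎-dec FinP.any? (λ i → Q ≟C incAt P i))

-- standardPaths n : all standard paths (P_0,...,P_n) of length n, each
-- exactly once, stored in REVERSE order (P_n first), so `head` is the
-- final composition P_n.
standardPaths : (n : ℕ) → List (Vec Composition (suc n))
standardPaths zero    = ([] Vec.∷ Vec.[]) ∷ []
standardPaths (suc n) =
  concatMap (λ p → map (λ Q → Q Vec.∷ p) (filter (λ Q → covers? Q (head p)) (comps (suc n))))
            (standardPaths n)

a : ℕ → ℕ → ℕ
a n k = length (filter (λ p → length (head p) ℕP.≟ k) (standardPaths n))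

-- Integer polynomials / formal power series via coefficients.
-- A polynomial is its list of coefficients [c_0, c_1, ...].

Poly : Set
Poly = List ℤ

coeff : Poly → ℕ → ℤ
coeff []       _       = 0ℤ
coeff (c ∷ cs) zero    = c
coeff (c ∷ cs) (suc n) = coeff cs n

_+P_ : Poly → Poly → Poly
[]       +P q        = q
(x ∷ xs) +P []       = x ∷ xs
(x ∷ xs) +P (y ∷ ys) = (x ℤ.+ y) ∷ (xs +P ys)

_*P_ : Poly → Poly → Poly
[]       *P q = []
(x ∷ xs) *P q = map (x ℤ.*_) q +P (0ℤ ∷ (xs *P q))

eval : Poly → ℤ → ℤ
eval p x = foldr (λ c acc → c ℤ.+ x ℤ.* acc) 0ℤ p

denom : ℕ → Poly
denom zero    = 1ℤ ∷ []
denom (suc k) = denom k *P (1ℤ ∷ ℤ.- (+ suc k) ∷ [])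

shiftP : ℕ → Poly → Poly
shiftP k p = replicate k 0ℤ ++ p

-- n-th coefficient of the product of a polynomial D with the power
-- series Σ_m f m t^m  :  Σ_{j=0}^{n} D_j f(n-j)
mulSeries : Poly → (ℕ → ℤ) → ℕ → ℤ
mulSeries D f n = foldr ℤ._+_ 0ℤ (map (λ j → coeff D j ℤ.* f (n ℕ.∸ j)) (upTo (suc n)))

HasDegree : Poly → ℕ → Set
HasDegree c d = Σ Poly λ c' → Σ ℤ λ e → (c ≡ c' ++ [ e ]) × (length c' ≡ d) × (e ≡ 0ℤ → ⊥)

{-# OPTIONS --safe #-}
module Submission where

-- A composition P with ℓ parts is covered by ℓ compositions with ℓ parts (raise one part) and by
-- 1 ∷ P and P ++ [ 1 ] with ℓ + 1 parts; the last two coincide exactly when every part is 1, and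
-- exactly one standard path of length m ends in such a composition. Summing over the standard
-- paths of length m gives
--   a (m + 1) (k + 1) + [m = k] = (k + 1) a m (k + 1) + 2 a m k,
-- that is (1 − (k + 1) t) L_{k+1} = t (2 L_k − t^k). By induction on k,
-- ∏_{i ≤ k} (1 − i t) L_k = t^k L̃_k where L̃_0 = 1 and L̃_{k+1} = 2 L̃_k − ∏_{i ≤ k} (1 − i t).
-- For k ≥ 1 the subtracted product has degree k and vanishes at t = 1, so L̃_{k+1} has degree k
-- and L̃_{k+1}(1) = 2 L̃_k(1).

open import Defs
open import Data.Bool using (if_then_else_)
open import Data.Nat using (ℕ; suc; _≤_; _∸_; _^_)
open import Data.Product using (Σ; _×_; _,_)
open import Relation.Binary.PropositionalEquality using (_≡_; refl)
open import Relation.Nullary using (Dec; does)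

iverson : ∀ {X : Set} → Dec X → ℕ
iverson d = if does d then 1 else 0

module PowerSeries where

  open import Data.Nat as ℕ using (zero)
  open import Data.Integer using (ℤ; +_; 0ℤ; _+_; _*_)
  import Data.Integer.Properties as ℤ
  open import Data.Integer.Tactic.RingSolver using (solve-∀)
  open import Data.List using (List; []; _∷_; map; applyUpTo; foldr)
  open import Function using (_∘_)
  open import Relation.Binary.PropositionalEquality

  -- A power series is its coefficient function; shift f is t · f, and D ⊛ f is the product of
  -- the polynomial D with f.

  Series : Set
  Series = ℕ → ℤ

  shift : Series → Series
  shift f zero    = 0ℤ
  shift f (suc n) = f n

  _⊕_ : Series → Series → Series
  (f ⊕ g) n = f n + g n

  _∙_ : ℤ → Series → Series
  (c ∙ f) n = c * f n

  infixl 6 _⊕_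
  infixr 7 _∙_ _⊛_

  _⊛_ : Poly → Series → Series
  ([]     ⊛ f) n = 0ℤ
  ((d ∷ D) ⊛ f) n = d * f n + shift (D ⊛ f) n

  shift-cong : ∀ {f g} → f ≗ g → shift f ≗ shift g
  shift-cong f≗g zero    = refl
  shift-cong f≗g (suc n) = f≗g n

  shift-⊕ : ∀ f g → shift (f ⊕ g) ≗ shift f ⊕ shift g
  shift-⊕ f g zero    = refl
  shift-⊕ f g (suc n) = refl

  shift-∙ : ∀ c f → shift (c ∙ f) ≗ c ∙ shift f
  shift-∙ c f zero    = sym (ℤ.*-zeroʳ c)
  shift-∙ c f (suc n) = refl

  ⊛-cong : ∀ D {f g} → f ≗ g → D ⊛ f ≗ D ⊛ g
  ⊛-cong []      f≗g n = refl
  ⊛-cong (d ∷ D) f≗g n = cong₂ (λ x y → d * x + y) (f≗g n) (shift-cong (⊛-cong D f≗g) n)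

  ⊛-shift : ∀ D f → D ⊛ shift f ≗ shift (D ⊛ f)
  ⊛-shift []      f zero    = refl
  ⊛-shift []      f (suc n) = refl
  ⊛-shift (d ∷ D) f zero    = trans (ℤ.+-identityʳ (d * 0ℤ)) (ℤ.*-zeroʳ d)
  ⊛-shift (d ∷ D) f (suc n) = cong (_+_ (d * f n)) (⊛-shift D f n)

  ⊛-distribˡ-⊕ : ∀ D f g → D ⊛ (f ⊕ g) ≗ D ⊛ f ⊕ D ⊛ g
  ⊛-distribˡ-⊕ []      f g n = refl
  ⊛-distribˡ-⊕ (d ∷ D) f g n = begin
    d * (f n + g n) + shift (D ⊛ (f ⊕ g)) n
      ≡⟨ cong (_+_ (d * (f n + g n))) (shift-cong (⊛-distribˡ-⊕ D f g) n) ⟩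
    d * (f n + g n) + shift (D ⊛ f ⊕ D ⊛ g) n
      ≡⟨ cong (_+_ (d * (f n + g n))) (shift-⊕ (D ⊛ f) (D ⊛ g) n) ⟩
    d * (f n + g n) + (shift (D ⊛ f) n + shift (D ⊛ g) n)
      ≡⟨ regroup d (f n) (g n) _ _ ⟩
    (d * f n + shift (D ⊛ f) n) + (d * g n + shift (D ⊛ g) n) ∎
    where
    open ≡-Reasoning
    regroup : ∀ d x y u v → d * (x + y) + (u + v) ≡ (d * x + u) + (d * y + v)
    regroup = solve-∀

  ⊛-∙-comm : ∀ D c f → D ⊛ (c ∙ f) ≗ c ∙ (D ⊛ f)
  ⊛-∙-comm []      c f n = sym (ℤ.*-zeroʳ c)
  ⊛-∙-comm (d ∷ D) c f n = begin
    d * (c * f n) + shift (D ⊛ (c ∙ f)) n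
      ≡⟨ cong (_+_ (d * (c * f n))) (shift-cong (⊛-∙-comm D c f) n) ⟩
    d * (c * f n) + shift (c ∙ (D ⊛ f)) n
      ≡⟨ cong (_+_ (d * (c * f n))) (shift-∙ c (D ⊛ f) n) ⟩
    d * (c * f n) + c * shift (D ⊛ f) n
      ≡⟨ regroup d c (f n) _ ⟩
    c * (d * f n + shift (D ⊛ f) n) ∎
    where
    open ≡-Reasoning
    regroup : ∀ d c x u → d * (c * x) + c * u ≡ c * (d * x + u)
    regroup = solve-∀

  ⊛-distribʳ-+P : ∀ p q f → (p +P q) ⊛ f ≗ p ⊛ f ⊕ q ⊛ f
  ⊛-distribʳ-+P []      q       f n = sym (ℤ.+-identityˡ _)
  ⊛-distribʳ-+P (x ∷ p) []      f n = sym (ℤ.+-identityʳ _)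
  ⊛-distribʳ-+P (x ∷ p) (y ∷ q) f n = begin
    (x + y) * f n + shift ((p +P q) ⊛ f) n
      ≡⟨ cong (_+_ ((x + y) * f n)) (shift-cong (⊛-distribʳ-+P p q f) n) ⟩
    (x + y) * f n + shift (p ⊛ f ⊕ q ⊛ f) n
      ≡⟨ cong (_+_ ((x + y) * f n)) (shift-⊕ (p ⊛ f) (q ⊛ f) n) ⟩
    (x + y) * f n + (shift (p ⊛ f) n + shift (q ⊛ f) n)
      ≡⟨ regroup x y (f n) _ _ ⟩
    (x * f n + shift (p ⊛ f) n) + (y * f n + shift (q ⊛ f) n) ∎
    where
    open ≡-Reasoning
    regroup : ∀ x y z u v → (x + y) * z + (u + v) ≡ (x * z + u) + (y * z + v)
    regroup = solve-∀

  map*-⊛ : ∀ c q f → map (c *_) q ⊛ f ≗ c ∙ (q ⊛ f)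
  map*-⊛ c []      f n = sym (ℤ.*-zeroʳ c)
  map*-⊛ c (y ∷ q) f n = begin
    c * y * f n + shift (map (c *_) q ⊛ f) n
      ≡⟨ cong (_+_ (c * y * f n)) (shift-cong (map*-⊛ c q f) n) ⟩
    c * y * f n + shift (c ∙ (q ⊛ f)) n
      ≡⟨ cong (_+_ (c * y * f n)) (shift-∙ c (q ⊛ f) n) ⟩
    c * y * f n + c * shift (q ⊛ f) n
      ≡⟨ regroup c y (f n) _ ⟩
    c * (y * f n + shift (q ⊛ f) n) ∎
    where
    open ≡-Reasoning
    regroup : ∀ c y z u → c * y * z + c * u ≡ c * (y * z + u)
    regroup = solve-∀

  *P-⊛-assoc : ∀ p q f → (p *P q) ⊛ f ≗ p ⊛ (q ⊛ f)
  *P-⊛-assoc []      q f n = refl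
  *P-⊛-assoc (x ∷ p) q f n = begin
    ((map (x *_) q +P (0ℤ ∷ p *P q)) ⊛ f) n
      ≡⟨ ⊛-distribʳ-+P (map (x *_) q) (0ℤ ∷ p *P q) f n ⟩
    (map (x *_) q ⊛ f) n + (0ℤ * f n + shift ((p *P q) ⊛ f) n)
      ≡⟨ cong₂ _+_ (map*-⊛ x q f n) (ℤ.+-identityˡ _) ⟩
    x * (q ⊛ f) n + shift ((p *P q) ⊛ f) n
      ≡⟨ cong (_+_ (x * (q ⊛ f) n)) (shift-cong (*P-⊛-assoc p q f) n) ⟩
    x * (q ⊛ f) n + shift (p ⊛ (q ⊛ f)) n ∎
    where open ≡-Reasoning

  private
    ∑ℤ : List ℤ → ℤ
    ∑ℤ = foldr _+_ 0ℤ

    ∑ℤ-map-applyUpTo : ∀ (h : ℕ → ℤ) g n → ∑ℤ (map h (applyUpTo g n)) ≡ ∑ℤ (applyUpTo (h ∘ g) n)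
    ∑ℤ-map-applyUpTo h g zero    = refl
    ∑ℤ-map-applyUpTo h g (suc n) = cong (_+_ (h (g 0))) (∑ℤ-map-applyUpTo h (g ∘ suc) n)

    ∑ℤ-zeros : ∀ n → ∑ℤ (applyUpTo (λ _ → 0ℤ) n) ≡ 0ℤ
    ∑ℤ-zeros zero    = refl
    ∑ℤ-zeros (suc n) = trans (ℤ.+-identityˡ _) (∑ℤ-zeros n)

    ∑ℤ-convolution : ∀ D f n → ∑ℤ (applyUpTo (λ j → coeff D j * f (n ∸ j)) (suc n)) ≡ (D ⊛ f) n
    ∑ℤ-convolution []      f n       = ∑ℤ-zeros (suc n)
    ∑ℤ-convolution (d ∷ D) f zero    = refl
    ∑ℤ-convolution (d ∷ D) f (suc n) = cong (_+_ (d * f (suc n))) (∑ℤ-convolution D f n)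

  mulSeries≗⊛ : ∀ D f → mulSeries D f ≗ D ⊛ f
  mulSeries≗⊛ D f n = trans (∑ℤ-map-applyUpTo (λ j → coeff D j * f (n ∸ j)) (λ j → j) (suc n)) (∑ℤ-convolution D f n)

  monomial : ℕ → Series
  monomial k m = + iverson (m ℕ.≟ k)

  monomial-suc : ∀ k → monomial (suc k) ≗ shift (monomial k)
  monomial-suc k zero    = refl
  monomial-suc k (suc m) = refl

  ⊛-monomial : ∀ k D → D ⊛ monomial k ≗ coeff (shiftP k D)
  ⊛-monomial zero    []      n       = refl
  ⊛-monomial zero    (d ∷ D) zero    = trans (ℤ.+-identityʳ _) (ℤ.*-identityʳ d)
  ⊛-monomial zero    (d ∷ D) (suc n) = begin
    d * 0ℤ + (D ⊛ monomial 0) n   ≡⟨ cong₂ _+_ (ℤ.*-zeroʳ d) (⊛-monomial 0 D n) ⟩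
    0ℤ + coeff D n                ≡⟨ ℤ.+-identityˡ _ ⟩
    coeff D n                     ∎
    where open ≡-Reasoning
  ⊛-monomial (suc k) D zero    = trans (⊛-cong D (monomial-suc k) 0) (⊛-shift D (monomial k) 0)
  ⊛-monomial (suc k) D (suc n) = begin
    (D ⊛ monomial (suc k)) (suc n)   ≡⟨ ⊛-cong D (monomial-suc k) (suc n) ⟩
    (D ⊛ shift (monomial k)) (suc n) ≡⟨ ⊛-shift D (monomial k) (suc n) ⟩
    (D ⊛ monomial k) n               ≡⟨ ⊛-monomial k D n ⟩
    coeff (shiftP k D) n             ∎
    where open ≡-Reasoning

module Numerator where

  open PowerSeries
  open import Data.Nat as ℕ using (zero; s≤s)
  import Data.Nat.Properties as ℕ
  open import Data.Integer using (ℤ; +_; 0ℤ; 1ℤ; -1ℤ; _+_; _*_; -_)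
  import Data.Integer.Properties as ℤ
  open import Data.Integer.Tactic.RingSolver using (solve-∀)
  open import Data.List using ([]; _∷_; [_]; _++_; map; length)
  import Data.List.Properties as List
  open import Data.Product as Product using (_,_; proj₁; proj₂)
  open import Data.Sum using ([_,_]′)
  open import Function using (_∘_)
  open import Relation.Binary.PropositionalEquality hiding ([_])

  L̃ : ℕ → Poly
  L̃ zero    = [ 1ℤ ]
  L̃ (suc k) = map (+ 2 *_) (L̃ k) +P map (-1ℤ *_) (denom k)

  module _ (A : ℕ → ℕ → ℕ)
           (A-column₀ : ∀ m → A m 0 ≡ iverson (m ℕ.≟ 0))
           (A-row₀ : ∀ k → A 0 (suc k) ≡ 0)
           (A-rec : ∀ m k → A (suc m) (suc k) ℕ.+ iverson (m ℕ.≟ k) ≡ suc k ℕ.* A m (suc k) ℕ.+ 2 ℕ.* A m k)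
           where

    column : ℕ → Series
    column k m = + A m k

    column-rec : ∀ m k →
      column (suc k) (suc m) ≡ + suc k * column (suc k) m + (+ 2 * column k m + -1ℤ * monomial k m)
    column-rec m k = begin
      + A (suc m) (suc k)
        ≡⟨ add-cancel (+ A (suc m) (suc k)) δ ⟩
      (+ A (suc m) (suc k) + δ) + -1ℤ * δ
        ≡⟨ cong (_+ -1ℤ * δ) (sym (ℤ.pos-+ (A (suc m) (suc k)) _)) ⟩
      + (A (suc m) (suc k) ℕ.+ iverson (m ℕ.≟ k)) + -1ℤ * δ
        ≡⟨ cong (λ z → + z + -1ℤ * δ) (A-rec m k) ⟩
      + (suc k ℕ.* A m (suc k) ℕ.+ 2 ℕ.* A m k) + -1ℤ * δ
        ≡⟨ cong (_+ -1ℤ * δ) (ℤ.pos-+ (suc k ℕ.* A m (suc k)) _) ⟩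
      (+ (suc k ℕ.* A m (suc k)) + + (2 ℕ.* A m k)) + -1ℤ * δ
        ≡⟨ cong₂ (λ x y → x + y + -1ℤ * δ) (ℤ.pos-* (suc k) (A m (suc k))) (ℤ.pos-* 2 (A m k)) ⟩
      (+ suc k * column (suc k) m + + 2 * column k m) + -1ℤ * δ
        ≡⟨ ℤ.+-assoc (+ suc k * column (suc k) m) (+ 2 * column k m) (-1ℤ * δ) ⟩
      + suc k * column (suc k) m + (+ 2 * column k m + -1ℤ * δ) ∎
      where
      open ≡-Reasoning
      δ : ℤ
      δ = monomial k m
      add-cancel : ∀ x d → x ≡ (x + d) + -1ℤ * d
      add-cancel = solve-∀

    column-equation : ∀ k →
      (1ℤ ∷ - (+ suc k) ∷ []) ⊛ column (suc k) ≗ shift (+ 2 ∙ column k ⊕ -1ℤ ∙ monomial k)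
    column-equation k zero rewrite A-row₀ k = refl
    column-equation k (suc m) = begin
      1ℤ * column (suc k) (suc m) + (- (+ suc k) * column (suc k) m + shift (λ _ → 0ℤ) m)
        ≡⟨ cong (λ z → 1ℤ * column (suc k) (suc m) + (- (+ suc k) * column (suc k) m + z)) (shift-zero m) ⟩
      1ℤ * column (suc k) (suc m) + (- (+ suc k) * column (suc k) m + 0ℤ)
        ≡⟨ cong (λ z → 1ℤ * z + (- (+ suc k) * column (suc k) m + 0ℤ)) (column-rec m k) ⟩
      1ℤ * (+ suc k * column (suc k) m + r) + (- (+ suc k) * column (suc k) m + 0ℤ)
        ≡⟨ cancel (+ suc k) (column (suc k) m) r ⟩
      r ∎
      where
      open ≡-Reasoning
      r : ℤ
      r = + 2 * column k m + -1ℤ * monomial k m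
      shift-zero : ∀ n → shift (λ _ → 0ℤ) n ≡ 0ℤ
      shift-zero zero    = refl
      shift-zero (suc n) = refl
      cancel : ∀ a b c → 1ℤ * (a * b + c) + (- a * b + 0ℤ) ≡ c
      cancel = solve-∀

    denom⊛column : ∀ k → denom k ⊛ column k ≗ L̃ k ⊛ monomial k
    denom⊛column zero    n = cong (λ z → 1ℤ * + z + shift (λ _ → 0ℤ) n) (A-column₀ n)
    denom⊛column (suc k) n = begin
      ((denom k *P linear) ⊛ column (suc k)) n
        ≡⟨ *P-⊛-assoc (denom k) linear (column (suc k)) n ⟩
      (denom k ⊛ (linear ⊛ column (suc k))) n
        ≡⟨ ⊛-cong (denom k) (column-equation k) n ⟩
      (denom k ⊛ shift (+ 2 ∙ column k ⊕ -1ℤ ∙ monomial k)) n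
        ≡⟨ ⊛-shift (denom k) _ n ⟩
      shift (denom k ⊛ (+ 2 ∙ column k ⊕ -1ℤ ∙ monomial k)) n
        ≡⟨ shift-cong (λ m → trans (⊛-distribˡ-⊕ (denom k) _ _ m)
                                   (cong₂ _+_ (⊛-∙-comm (denom k) (+ 2) (column k) m)
                                              (⊛-∙-comm (denom k) -1ℤ (monomial k) m))) n ⟩
      shift (+ 2 ∙ (denom k ⊛ column k) ⊕ -1ℤ ∙ (denom k ⊛ monomial k)) n
        ≡⟨ shift-cong (λ m → cong (λ z → + 2 * z + -1ℤ * (denom k ⊛ monomial k) m) (denom⊛column k m)) n ⟩
      shift (+ 2 ∙ (L̃ k ⊛ monomial k) ⊕ -1ℤ ∙ (denom k ⊛ monomial k)) n
        ≡⟨ shift-cong (λ m → sym (trans (⊛-distribʳ-+P (map (+ 2 *_) (L̃ k)) _ _ m)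
                                        (cong₂ _+_ (map*-⊛ (+ 2) (L̃ k) _ m) (map*-⊛ -1ℤ (denom k) _ m)))) n ⟩
      shift (L̃ (suc k) ⊛ monomial k) n
        ≡⟨ sym (⊛-shift (L̃ (suc k)) (monomial k) n) ⟩
      (L̃ (suc k) ⊛ shift (monomial k)) n
        ≡⟨ sym (⊛-cong (L̃ (suc k)) (monomial-suc k) n) ⟩
      (L̃ (suc k) ⊛ monomial (suc k)) n ∎
      where
      open ≡-Reasoning
      linear : Poly
      linear = 1ℤ ∷ - (+ suc k) ∷ []

    mulSeries-denom-column : ∀ k → mulSeries (denom k) (column k) ≗ coeff (shiftP k (L̃ k))
    mulSeries-denom-column k n = begin
      mulSeries (denom k) (column k) n ≡⟨ mulSeries≗⊛ (denom k) (column k) n ⟩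
      (denom k ⊛ column k) n           ≡⟨ denom⊛column k n ⟩
      (L̃ k ⊛ monomial k) n             ≡⟨ ⊛-monomial k (L̃ k) n ⟩
      coeff (shiftP k (L̃ k)) n         ∎
      where open ≡-Reasoning

  eval-+P : ∀ p q x → eval (p +P q) x ≡ eval p x + eval q x
  eval-+P []      q       x = sym (ℤ.+-identityˡ _)
  eval-+P (a ∷ p) []      x = sym (ℤ.+-identityʳ _)
  eval-+P (a ∷ p) (b ∷ q) x =
    trans (cong (λ z → a + b + x * z) (eval-+P p q x)) (regroup a b x (eval p x) (eval q x))
    where
    regroup : ∀ a b x u v → a + b + x * (u + v) ≡ (a + x * u) + (b + x * v)
    regroup = solve-∀

  eval-map* : ∀ c p x → eval (map (c *_) p) x ≡ c * eval p x
  eval-map* c []      x = sym (ℤ.*-zeroʳ c)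
  eval-map* c (a ∷ p) x =
    trans (cong (λ z → c * a + x * z) (eval-map* c p x)) (regroup c a x (eval p x))
    where
    regroup : ∀ c a x u → c * a + x * (c * u) ≡ c * (a + x * u)
    regroup = solve-∀

  eval-*P : ∀ p q x → eval (p *P q) x ≡ eval p x * eval q x
  eval-*P []      q x = refl
  eval-*P (a ∷ p) q x = begin
    eval (map (a *_) q +P (0ℤ ∷ p *P q)) x
      ≡⟨ eval-+P (map (a *_) q) (0ℤ ∷ p *P q) x ⟩
    eval (map (a *_) q) x + (0ℤ + x * eval (p *P q) x)
      ≡⟨ cong₂ (λ u v → u + (0ℤ + x * v)) (eval-map* a q x) (eval-*P p q x) ⟩
    a * eval q x + (0ℤ + x * (eval p x * eval q x))
      ≡⟨ regroup a x (eval p x) (eval q x) ⟩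
    (a + x * eval p x) * eval q x ∎
    where
    open ≡-Reasoning
    regroup : ∀ a x u v → a * v + (0ℤ + x * (u * v)) ≡ (a + x * u) * v
    regroup = solve-∀

  denom-root : ∀ k → eval (denom (suc k)) (+ 1) ≡ 0ℤ
  denom-root zero    = refl
  denom-root (suc k) =
    trans (eval-*P (denom (suc k)) _ (+ 1)) (cong (_* eval (1ℤ ∷ - (+ suc (suc k)) ∷ []) (+ 1)) (denom-root k))

  eval-L̃ : ∀ k → eval (L̃ k) (+ 1) ≡ + (2 ^ (k ∸ 1))
  eval-L̃ zero          = refl
  eval-L̃ (suc zero)    = refl
  eval-L̃ (suc (suc k)) = begin
    eval (map (+ 2 *_) (L̃ (suc k)) +P map (-1ℤ *_) (denom (suc k))) (+ 1)
      ≡⟨ eval-+P (map (+ 2 *_) (L̃ (suc k))) _ (+ 1) ⟩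
    eval (map (+ 2 *_) (L̃ (suc k))) (+ 1) + eval (map (-1ℤ *_) (denom (suc k))) (+ 1)
      ≡⟨ cong₂ _+_ (eval-map* (+ 2) (L̃ (suc k)) (+ 1)) (eval-map* -1ℤ (denom (suc k)) (+ 1)) ⟩
    + 2 * eval (L̃ (suc k)) (+ 1) + -1ℤ * eval (denom (suc k)) (+ 1)
      ≡⟨ cong₂ (λ u v → + 2 * u + -1ℤ * v) (eval-L̃ (suc k)) (denom-root k) ⟩
    + 2 * + (2 ^ k) + 0ℤ
      ≡⟨ ℤ.+-identityʳ _ ⟩
    + 2 * + (2 ^ k)
      ≡⟨ sym (ℤ.pos-* 2 (2 ^ k)) ⟩
    + (2 ^ suc k) ∎
    where open ≡-Reasoning

  HasDegree⇒length : ∀ {p d} → HasDegree p d → length p ≡ suc d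
  HasDegree⇒length (c , e , refl , refl , _) = trans (List.length-++ c) (ℕ.+-comm (length c) 1)

  ++-*P-linear : ∀ c e u v →
    Σ Poly λ c′ → ((c ++ [ e ]) *P (u ∷ v ∷ []) ≡ c′ ++ [ e * v ]) × (length c′ ≡ suc (length c))
  ++-*P-linear []      e u v = [ e * u + 0ℤ ] , refl , refl
  ++-*P-linear (x ∷ c) e u v with ++-*P-linear c e u v
  ... | [] , _ , ()
  ... | y ∷ c′ , eq , len =
    (x * u + 0ℤ) ∷ (x * v + y) ∷ c′ , cong (λ z → (x * u ∷ x * v ∷ []) +P (0ℤ ∷ z)) eq , cong suc len

  HasDegree-*P-linear : ∀ {p d} u {v} → v ≢ 0ℤ → HasDegree p d → HasDegree (p *P (u ∷ v ∷ [])) (suc d)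
  HasDegree-*P-linear u {v} v≢0 (c , e , refl , refl , e≢0) with ++-*P-linear c e u v
  ... | c′ , eq , len = c′ , e * v , eq , len , [ e≢0 , v≢0 ]′ ∘ ℤ.i*j≡0⇒i≡0∨j≡0 e {v}

  HasDegree-map* : ∀ {p d c} → c ≢ 0ℤ → HasDegree p d → HasDegree (map (c *_) p) d
  HasDegree-map* {c = c} c≢0 (p , e , refl , refl , e≢0) =
    map (c *_) p , c * e , List.map-++ (c *_) p [ e ] , List.length-map (c *_) p ,
    [ c≢0 , e≢0 ]′ ∘ ℤ.i*j≡0⇒i≡0∨j≡0 c {e}

  +P-++ : ∀ p c r → length p ≤ length c → (p +P (c ++ r) ≡ (p +P c) ++ r) × (length (p +P c) ≡ length c)
  +P-++ []      c       r p≤c       = refl , refl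
  +P-++ (x ∷ p) (y ∷ c) r (s≤s p≤c) = Product.map (cong ((x + y) ∷_)) (cong suc) (+P-++ p c r p≤c)

  HasDegree-+P : ∀ {p q d} → length p ≤ d → HasDegree q d → HasDegree (p +P q) d
  HasDegree-+P {p} p≤d (c , e , refl , refl , e≢0) =
    p +P c , e , proj₁ (+P-++ p c [ e ] p≤d) , proj₂ (+P-++ p c [ e ] p≤d) , e≢0

  denom-degree : ∀ k → HasDegree (denom k) k
  denom-degree zero    = [] , 1ℤ , refl , refl , λ ()
  denom-degree (suc k) = HasDegree-*P-linear 1ℤ (λ ()) (denom-degree k)

  L̃-degree : ∀ j → HasDegree (L̃ (suc j)) j
  L̃-degree zero    = [] , 1ℤ , refl , refl , λ ()
  L̃-degree (suc j) =
    HasDegree-+P (ℕ.≤-reflexive (trans (List.length-map (+ 2 *_) (L̃ (suc j))) (HasDegree⇒length (L̃-degree j))))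
                 (HasDegree-map* {c = -1ℤ} (λ ()) (denom-degree (suc j)))

module FiniteSums where

  open import Data.Nat as ℕ using (_+_; _*_)
  import Data.Nat.Properties as ℕ
  open import Data.Nat.Tactic.RingSolver using (solve-∀)
  open import Data.List using (List; []; _∷_; _++_; length; map; filter; concatMap)
  open import Data.List.Relation.Unary.All using (All; []; _∷_)
  open import Data.Empty using (⊥-elim)
  open import Function using (_∘_)
  open import Relation.Nullary using (yes; no; ¬_)
  open import Relation.Unary using (Pred; Decidable)
  open import Relation.Binary.PropositionalEquality

  iverson-yes : ∀ {X : Set} (d : Dec X) → X → iverson d ≡ 1
  iverson-yes (yes _) x = refl
  iverson-yes (no ¬x) x = ⊥-elim (¬x x)

  iverson-no : ∀ {X : Set} (d : Dec X) → ¬ X → iverson d ≡ 0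
  iverson-no (yes x) ¬x = ⊥-elim (¬x x)
  iverson-no (no _)  ¬x = refl

  iverson-cong : ∀ {X Y : Set} (d : Dec X) (e : Dec Y) → (X → Y) → (Y → X) → iverson d ≡ iverson e
  iverson-cong (yes x) e f g = sym (iverson-yes e (f x))
  iverson-cong (no ¬x) e f g = sym (iverson-no e (¬x ∘ g))

  iverson-≡-* : ∀ m n (d : Dec (m ≡ n)) → iverson d * m ≡ n * iverson d
  iverson-≡-* m n (yes refl) = ℕ.*-comm 1 m
  iverson-≡-* m n (no _)     = sym (ℕ.*-zeroʳ n)

  ∑ : ∀ {A : Set} → List A → (A → ℕ) → ℕ
  ∑ []       w = 0
  ∑ (x ∷ xs) w = w x + ∑ xs w

  ∑-++ : ∀ {A : Set} (xs ys : List A) w → ∑ (xs ++ ys) w ≡ ∑ xs w + ∑ ys w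
  ∑-++ []       ys w = refl
  ∑-++ (x ∷ xs) ys w = trans (cong (w x +_) (∑-++ xs ys w)) (sym (ℕ.+-assoc (w x) _ _))

  ∑-concatMap : ∀ {A B : Set} (f : A → List B) (xs : List A) w → ∑ (concatMap f xs) w ≡ ∑ xs (λ x → ∑ (f x) w)
  ∑-concatMap f []       w = refl
  ∑-concatMap f (x ∷ xs) w = trans (∑-++ (f x) (concatMap f xs) w) (cong (∑ (f x) w +_) (∑-concatMap f xs w))

  ∑-map : ∀ {A B : Set} (g : A → B) (xs : List A) w → ∑ (map g xs) w ≡ ∑ xs (w ∘ g)
  ∑-map g []       w = refl
  ∑-map g (x ∷ xs) w = cong (w (g x) +_) (∑-map g xs w)

  ∑-filter : ∀ {A : Set} {P : Pred A _} (P? : Decidable P) (xs : List A) w → ∑ (filter P? xs) w ≡ ∑ xs (λ x → iverson (P? x) * w x)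
  ∑-filter P? []       w = refl
  ∑-filter P? (x ∷ xs) w with P? x
  ... | yes _ = cong₂ _+_ (sym (ℕ.+-identityʳ (w x))) (∑-filter P? xs w)
  ... | no _  = ∑-filter P? xs w

  length-filter≡∑ : ∀ {A : Set} {P : Pred A _} (P? : Decidable P) (xs : List A) → length (filter P? xs) ≡ ∑ xs (iverson ∘ P?)
  length-filter≡∑ P? []       = refl
  length-filter≡∑ P? (x ∷ xs) with P? x
  ... | yes _ = cong suc (length-filter≡∑ P? xs)
  ... | no _  = length-filter≡∑ P? xs

  ∑-cong : ∀ {A : Set} (xs : List A) {w v : A → ℕ} → (∀ x → w x ≡ v x) → ∑ xs w ≡ ∑ xs v
  ∑-cong []       w≗v = refl
  ∑-cong (x ∷ xs) w≗v = cong₂ _+_ (w≗v x) (∑-cong xs w≗v)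

  ∑-cong-All : ∀ {A : Set} {Q : A → Set} {xs : List A} {w v : A → ℕ} → All Q xs → (∀ {x} → Q x → w x ≡ v x) → ∑ xs w ≡ ∑ xs v
  ∑-cong-All []       w≗v = refl
  ∑-cong-All (q ∷ qs) w≗v = cong₂ _+_ (w≗v q) (∑-cong-All qs w≗v)

  ∑-+ : ∀ {A : Set} (xs : List A) (w v : A → ℕ) → ∑ xs (λ x → w x + v x) ≡ ∑ xs w + ∑ xs v
  ∑-+ []       w v = refl
  ∑-+ (x ∷ xs) w v = trans (cong (w x + v x +_) (∑-+ xs w v)) (regroup (w x) (v x) (∑ xs w) (∑ xs v))
    where
    regroup : ∀ a b c d → a + b + (c + d) ≡ a + c + (b + d)
    regroup = solve-∀

  ∑-*ˡ : ∀ {A : Set} (xs : List A) c (w : A → ℕ) → ∑ xs (λ x → c * w x) ≡ c * ∑ xs w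
  ∑-*ˡ []       c w = sym (ℕ.*-zeroʳ c)
  ∑-*ˡ (x ∷ xs) c w = trans (cong (c * w x +_) (∑-*ˡ xs c w)) (sym (ℕ.*-distribˡ-+ c (w x) _))

  ∑-zero : ∀ {A : Set} (xs : List A) → ∑ xs (λ _ → 0) ≡ 0
  ∑-zero []       = refl
  ∑-zero (x ∷ xs) = ∑-zero xs

  ∑-const : ∀ {A : Set} (xs : List A) c → ∑ xs (λ _ → c) ≡ length xs * c
  ∑-const []       c = refl
  ∑-const (x ∷ xs) c = cong (c +_) (∑-const xs c)

  ∑-swap : ∀ {A B : Set} (xs : List A) (ys : List B) (f : A → B → ℕ) →
    ∑ xs (λ x → ∑ ys (f x)) ≡ ∑ ys (λ y → ∑ xs (λ x → f x y))
  ∑-swap []       ys f = sym (∑-zero ys)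
  ∑-swap (x ∷ xs) ys f =
    trans (cong (∑ ys (f x) +_) (∑-swap xs ys f)) (sym (∑-+ ys (f x) (λ y → ∑ xs (λ x′ → f x′ y))))

module Counting where

  open FiniteSums
  open import Data.Nat as ℕ using (zero; _+_; _*_; _<_; _≟_; s≤s; z≤n)
  import Data.Nat.Properties as ℕ
  open import Data.Nat.Tactic.RingSolver using (solve-∀)
  open import Data.List using (List; []; _∷_; _++_; [_]; length; map; filter; concat; concatMap)
  import Data.List.Properties as List
  open import Data.List.Relation.Unary.All as All using (All; []; _∷_; all?)
  import Data.List.Relation.Unary.All.Properties as All
  import Data.Fin as Fin
  open import Data.Vec as Vec using (Vec; head)
  open import Data.Product using (∃; _,_; proj₁; proj₂)
  open import Data.Sum using (_⊎_; inj₁; inj₂)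
  open import Function using (_∘_)
  open import Relation.Nullary using (yes; no; ¬_)
  open import Relation.Unary using (Pred; Decidable)
  open import Relation.Binary.PropositionalEquality hiding ([_])

  Positive : Composition → Set
  Positive = All (0 <_)

  IsComposition : ℕ → Composition → Set
  IsComposition n Q = Positive Q × weight Q ≡ n

  multiplicity : Composition → List Composition → ℕ
  multiplicity Q Rs = ∑ Rs (λ R → iverson (Q ≟C R))

  iverson-≟C-sym : ∀ Q R → iverson (Q ≟C R) ≡ iverson (R ≟C Q)
  iverson-≟C-sym Q R = iverson-cong (Q ≟C R) (R ≟C Q) sym sym

  multiplicity-none : ∀ {Q Rs} → All (Q ≢_) Rs → multiplicity Q Rs ≡ 0
  multiplicity-none []           = refl
  multiplicity-none {Q} {R ∷ _} (Q≢R ∷ Q≢Rs) = cong₂ _+_ (iverson-no (Q ≟C R) Q≢R) (multiplicity-none Q≢Rs)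

  multiplicity-map-∷ : ∀ p Q Rs → multiplicity (p ∷ Q) (map (p ∷_) Rs) ≡ multiplicity Q Rs
  multiplicity-map-∷ p Q []       = refl
  multiplicity-map-∷ p Q (R ∷ Rs) =
    cong₂ _+_ (iverson-cong ((p ∷ Q) ≟C (p ∷ R)) (Q ≟C R) (proj₂ ∘ List.∷-injective) (cong (p ∷_)))
              (multiplicity-map-∷ p Q Rs)

  multiplicity-filter : ∀ {A : Pred Composition _} (A? : Decidable A) Q Rs →
    multiplicity Q (filter A? Rs) ≡ iverson (A? Q) * multiplicity Q Rs
  multiplicity-filter A? Q Rs = begin
    multiplicity Q (filter A? Rs)              ≡⟨ ∑-filter A? Rs _ ⟩
    ∑ Rs (λ R → iverson (A? R) * iverson (Q ≟C R)) ≡⟨ ∑-cong Rs (λ R → iverson-≟C-transport R (Q ≟C R)) ⟩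
    ∑ Rs (λ R → iverson (A? Q) * iverson (Q ≟C R)) ≡⟨ ∑-*ˡ Rs (iverson (A? Q)) _ ⟩
    iverson (A? Q) * multiplicity Q Rs         ∎
    where
    open ≡-Reasoning
    iverson-≟C-transport : ∀ R (d : Dec (Q ≡ R)) → iverson (A? R) * iverson d ≡ iverson (A? Q) * iverson d
    iverson-≟C-transport R (yes refl) = refl
    iverson-≟C-transport R (no _)     = trans (ℕ.*-zeroʳ (iverson (A? R))) (sym (ℕ.*-zeroʳ (iverson (A? Q))))

  -- grow is the step function of comps, which is local to Defs.
  grow : Composition → List Composition
  grow []       = [ 1 ∷ [] ]
  grow (p ∷ ps) = (1 ∷ p ∷ ps) ∷ (suc p ∷ ps) ∷ []

  comps-suc : ∀ n → comps (suc n) ≡ concatMap grow (comps n)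
  comps-suc n = cong concat (List.map-cong (λ { [] → refl ; (p ∷ ps) → refl }) (comps n))

  grow-valid : ∀ {n P} → IsComposition n P → All (IsComposition (suc n)) (grow P)
  grow-valid {P = []}     (_ , w)          = ((s≤s z≤n ∷ []) , cong suc w) ∷ []
  grow-valid {P = p ∷ ps} (p>0 ∷ ps>0 , w) =
    ((s≤s z≤n ∷ p>0 ∷ ps>0) , cong suc w) ∷ ((s≤s z≤n ∷ ps>0) , cong suc w) ∷ []

  comps-valid : ∀ n → All (IsComposition n) (comps n)
  comps-valid zero    = ([] , refl) ∷ []
  comps-valid (suc n) rewrite comps-suc n = All.concat⁺ (All.map⁺ (All.map grow-valid (comps-valid n)))

  shrink : Composition → Composition
  shrink (suc zero ∷ Q)    = Q
  shrink (suc (suc q) ∷ Q) = suc q ∷ Q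
  shrink Q                 = Q

  shrink-valid : ∀ {n Q} → IsComposition (suc n) Q → IsComposition n (shrink Q)
  shrink-valid {Q = suc zero ∷ Q}    (_ ∷ Q>0 , w) = Q>0 , ℕ.suc-injective w
  shrink-valid {Q = suc (suc q) ∷ Q} (_ ∷ Q>0 , w) = (s≤s z≤n ∷ Q>0) , ℕ.suc-injective w

  -- Equality tests of lists with known first parts compute, so every case reduces to refl or n + 0 ≡ n.
  multiplicity-grow : ∀ q Q {P} → Positive P → multiplicity (q ∷ Q) (grow P) ≡ iverson (shrink (q ∷ Q) ≟C P)
  multiplicity-grow zero          Q {[]}         _ = refl
  multiplicity-grow (suc zero)    Q {[]}         _ = ℕ.+-identityʳ _
  multiplicity-grow (suc (suc q)) Q {[]}         _ = refl
  multiplicity-grow zero          Q {suc p ∷ ps} _ = refl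
  multiplicity-grow (suc zero)    Q {suc p ∷ ps} _ = ℕ.+-identityʳ _
  multiplicity-grow (suc (suc q)) Q {suc p ∷ ps} _ = ℕ.+-identityʳ _
  multiplicity-grow q             Q {zero ∷ ps}  (() ∷ _)

  multiplicity-comps : ∀ n {Q} → IsComposition n Q → multiplicity Q (comps n) ≡ 1
  multiplicity-comps zero    {[]}         _ = refl
  multiplicity-comps zero    {zero ∷ Q}   (() ∷ _ , _)
  multiplicity-comps zero    {suc q ∷ Q}  (_ , ())
  multiplicity-comps (suc n) {[]}         (_ , ())
  multiplicity-comps (suc n) {q ∷ Q}      Q-valid rewrite comps-suc n = begin
    multiplicity (q ∷ Q) (concatMap grow (comps n))
      ≡⟨ ∑-concatMap grow (comps n) _ ⟩
    ∑ (comps n) (multiplicity (q ∷ Q) ∘ grow)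
      ≡⟨ ∑-cong-All (comps-valid n) (multiplicity-grow q Q ∘ proj₁) ⟩
    multiplicity (shrink (q ∷ Q)) (comps n)
      ≡⟨ multiplicity-comps n (shrink-valid Q-valid) ⟩
    1 ∎
    where open ≡-Reasoning

  AllOnes : Composition → Set
  AllOnes = All (_≡ 1)

  allOnes? : Decidable AllOnes
  allOnes? = all? (_≟ 1)

  AllOnes⇒++[1]≡1∷ : ∀ {P} → AllOnes P → P ++ [ 1 ] ≡ 1 ∷ P
  AllOnes⇒++[1]≡1∷ []           = refl
  AllOnes⇒++[1]≡1∷ (refl ∷ ones) = cong (1 ∷_) (AllOnes⇒++[1]≡1∷ ones)

  ++[1]≡1∷⇒AllOnes : ∀ P → P ++ [ 1 ] ≡ 1 ∷ P → AllOnes P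
  ++[1]≡1∷⇒AllOnes []       _  = []
  ++[1]≡1∷⇒AllOnes (p ∷ ps) eq with List.∷-injective eq
  ... | refl , eq′ = refl ∷ ++[1]≡1∷⇒AllOnes ps eq′

  length-++[1] : ∀ P → length (P ++ [ 1 ]) ≡ suc (length P)
  length-++[1] P = trans (List.length-++ P) (ℕ.+-comm (length P) 1)

  weight-++[1] : ∀ P → weight (P ++ [ 1 ]) ≡ suc (weight P)
  weight-++[1] []       = refl
  weight-++[1] (p ∷ ps) = trans (cong (p +_) (weight-++[1] ps)) (ℕ.+-suc p (weight ps))

  length-incAt : ∀ P i → length (incAt P i) ≡ length P
  length-incAt (p ∷ ps) Fin.zero    = refl
  length-incAt (p ∷ ps) (Fin.suc i) = cong suc (length-incAt ps i)

  raisedCovers : Composition → List Composition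
  raisedCovers []       = []
  raisedCovers (p ∷ ps) = (suc p ∷ ps) ∷ map (p ∷_) (raisedCovers ps)

  length-raisedCovers : ∀ P → length (raisedCovers P) ≡ length P
  length-raisedCovers []       = refl
  length-raisedCovers (p ∷ ps) = cong suc (trans (List.length-map (p ∷_) (raisedCovers ps)) (length-raisedCovers ps))

  raisedCovers-parts : ∀ P → All (λ Q → length Q ≡ length P) (raisedCovers P)
  raisedCovers-parts []       = []
  raisedCovers-parts (p ∷ ps) = refl ∷ All.map⁺ (All.map (cong suc) (raisedCovers-parts ps))

  raisedCovers-sound : ∀ P → All (λ Q → ∃ λ i → Q ≡ incAt P i) (raisedCovers P)
  raisedCovers-sound []       = []
  raisedCovers-sound (p ∷ ps) =
    (Fin.zero , refl) ∷ All.map⁺ (All.map (λ { (i , eq) → Fin.suc i , cong (p ∷_) eq }) (raisedCovers-sound ps))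

  raisedCovers-valid : ∀ {P} → Positive P → All (λ Q → Positive Q × weight Q ≡ suc (weight P)) (raisedCovers P)
  raisedCovers-valid []               = []
  raisedCovers-valid {p ∷ ps} (p>0 ∷ ps>0) =
    ((s≤s z≤n ∷ ps>0) , refl) ∷
    All.map⁺ (All.map (λ { (Q>0 , w) → (p>0 ∷ Q>0) , trans (cong (p +_) w) (ℕ.+-suc p (weight ps)) })
                      (raisedCovers-valid ps>0))

  raisedCovers-notAllOnes : ∀ {P} → Positive P → All (¬_ ∘ AllOnes) (raisedCovers P)
  raisedCovers-notAllOnes []                     = []
  raisedCovers-notAllOnes {p ∷ ps} (s≤s p>0 ∷ ps>0) =
    (λ { (eq ∷ _) → ℕ.<⇒≢ (s≤s p>0) (sym (ℕ.suc-injective eq)) }) ∷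
    All.map⁺ (All.map (λ ¬ones → λ { (_ ∷ ones) → ¬ones ones }) (raisedCovers-notAllOnes ps>0))

  multiplicity-raisedCovers : ∀ P i → multiplicity (incAt P i) (raisedCovers P) ≡ 1
  multiplicity-raisedCovers (p ∷ ps) Fin.zero =
    cong₂ _+_ (iverson-yes ((suc p ∷ ps) ≟C (suc p ∷ ps)) refl)
              (multiplicity-none (All.map⁺ (All.universal (λ _ eq → ℕ.1+n≢n (proj₁ (List.∷-injective eq)))
                                                           (raisedCovers ps))))
  multiplicity-raisedCovers (p ∷ ps) (Fin.suc i) =
    cong₂ _+_ (iverson-no ((p ∷ incAt ps i) ≟C (suc p ∷ ps)) (ℕ.1+n≢n ∘ sym ∘ proj₁ ∘ List.∷-injective))
              (trans (multiplicity-map-∷ p (incAt ps i) (raisedCovers ps)) (multiplicity-raisedCovers ps i))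

  multiplicity-raisedCovers-parts : ∀ {Q} P → length Q ≢ length P → multiplicity Q (raisedCovers P) ≡ 0
  multiplicity-raisedCovers-parts {Q} P Q≉P =
    multiplicity-none (All.map (λ {R} R≈P (Q≡R : Q ≡ R) → Q≉P (trans (cong length Q≡R) R≈P)) (raisedCovers-parts P))

  appendedCover : (P : Composition) → Dec (AllOnes P) → List Composition
  appendedCover P (yes _) = []
  appendedCover P (no _)  = [ P ++ [ 1 ] ]

  -- P ++ [ 1 ] is left out exactly when it coincides with 1 ∷ P, so no cover is listed twice.
  upperCovers : Composition → List Composition
  upperCovers P = (1 ∷ P) ∷ appendedCover P (allOnes? P) ++ raisedCovers P

  upperCovers-sound : ∀ P → All (λ Q → Covers Q P) (upperCovers P)
  upperCovers-sound P = inj₁ refl ∷ All.++⁺ (appended (allOnes? P)) (All.map (inj₂ ∘ inj₂) (raisedCovers-sound P))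
    where
    appended : (d : Dec (AllOnes P)) → All (λ Q → Covers Q P) (appendedCover P d)
    appended (yes _) = []
    appended (no _)  = inj₂ (inj₁ refl) ∷ []

  upperCovers-valid : ∀ {m P} → IsComposition m P → All (IsComposition (suc m)) (upperCovers P)
  upperCovers-valid {m} {P} (P>0 , w) =
    ((s≤s z≤n ∷ P>0) , cong suc w) ∷
    All.++⁺ (appended (allOnes? P)) (All.map (λ { (Q>0 , w′) → Q>0 , trans w′ (cong suc w) }) (raisedCovers-valid P>0))
    where
    appended : (d : Dec (AllOnes P)) → All (IsComposition (suc m)) (appendedCover P d)
    appended (yes _) = []
    appended (no _)  = (All.++⁺ P>0 (s≤s z≤n ∷ []) , trans (weight-++[1] P) (cong suc w)) ∷ []

  multiplicity-upperCovers-split : ∀ Q P → multiplicity Q (upperCovers P) ≡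
    iverson (Q ≟C (1 ∷ P)) + multiplicity Q (appendedCover P (allOnes? P)) + multiplicity Q (raisedCovers P)
  multiplicity-upperCovers-split Q P =
    trans (cong (iverson (Q ≟C (1 ∷ P)) +_) (∑-++ (appendedCover P (allOnes? P)) (raisedCovers P) _))
          (sym (ℕ.+-assoc (iverson (Q ≟C (1 ∷ P))) _ _))

  multiplicity-longCover : ∀ {Q P} → Q ≡ 1 ∷ P ⊎ Q ≡ P ++ [ 1 ] → (d : Dec (AllOnes P)) →
    iverson (Q ≟C (1 ∷ P)) + multiplicity Q (appendedCover P d) ≡ 1
  multiplicity-longCover {P = P} (inj₁ refl) (yes _) =
    cong (_+ 0) (iverson-yes ((1 ∷ P) ≟C (1 ∷ P)) refl)
  multiplicity-longCover {P = P} (inj₁ refl) (no ¬ones) =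
    cong₂ _+_ (iverson-yes ((1 ∷ P) ≟C (1 ∷ P)) refl)
              (cong (_+ 0) (iverson-no ((1 ∷ P) ≟C (P ++ [ 1 ])) (¬ones ∘ ++[1]≡1∷⇒AllOnes P ∘ sym)))
  multiplicity-longCover {P = P} (inj₂ refl) (yes ones) =
    cong (_+ 0) (iverson-yes ((P ++ [ 1 ]) ≟C (1 ∷ P)) (AllOnes⇒++[1]≡1∷ ones))
  multiplicity-longCover {P = P} (inj₂ refl) (no ¬ones) =
    cong₂ _+_ (iverson-no ((P ++ [ 1 ]) ≟C (1 ∷ P)) (¬ones ∘ ++[1]≡1∷⇒AllOnes P))
              (cong (_+ 0) (iverson-yes ((P ++ [ 1 ]) ≟C (P ++ [ 1 ])) refl))

  multiplicity-appendedCover-parts : ∀ {Q} P → length Q ≡ length P → (d : Dec (AllOnes P)) →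
    multiplicity Q (appendedCover P d) ≡ 0
  multiplicity-appendedCover-parts P Q≈P (yes _) = refl
  multiplicity-appendedCover-parts {Q} P Q≈P (no _) =
    cong (_+ 0) (iverson-no (Q ≟C (P ++ [ 1 ]))
                            (λ Q≡ → ℕ.1+n≢n (sym (trans (sym Q≈P) (trans (cong length Q≡) (length-++[1] P))))))

  multiplicity-cover : ∀ {Q P} → Covers Q P → multiplicity Q (upperCovers P) ≡ 1
  multiplicity-cover {Q} {P} (inj₁ Q≡1∷P) = begin
    multiplicity Q (upperCovers P)
      ≡⟨ multiplicity-upperCovers-split Q P ⟩
    iverson (Q ≟C (1 ∷ P)) + multiplicity Q (appendedCover P (allOnes? P)) + multiplicity Q (raisedCovers P)
      ≡⟨ cong₂ _+_ (multiplicity-longCover (inj₁ Q≡1∷P) (allOnes? P))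
                   (multiplicity-raisedCovers-parts {Q} P (λ Q≈P → ℕ.1+n≢n (trans (sym (cong length Q≡1∷P)) Q≈P))) ⟩
    1 ∎
    where open ≡-Reasoning
  multiplicity-cover {Q} {P} (inj₂ (inj₁ Q≡P++[1])) = begin
    multiplicity Q (upperCovers P)
      ≡⟨ multiplicity-upperCovers-split Q P ⟩
    iverson (Q ≟C (1 ∷ P)) + multiplicity Q (appendedCover P (allOnes? P)) + multiplicity Q (raisedCovers P)
      ≡⟨ cong₂ _+_ (multiplicity-longCover (inj₂ Q≡P++[1]) (allOnes? P))
                   (multiplicity-raisedCovers-parts {Q} P
                      (λ Q≈P → ℕ.1+n≢n (trans (sym (trans (cong length Q≡P++[1]) (length-++[1] P))) Q≈P))) ⟩
    1 ∎
    where open ≡-Reasoning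
  multiplicity-cover {P = P} (inj₂ (inj₂ (i , refl))) = begin
    multiplicity (incAt P i) (upperCovers P)
      ≡⟨ multiplicity-upperCovers-split (incAt P i) P ⟩
    iverson (incAt P i ≟C (1 ∷ P)) + multiplicity (incAt P i) (appendedCover P (allOnes? P))
      + multiplicity (incAt P i) (raisedCovers P)
      ≡⟨ cong₂ _+_ (cong₂ _+_ (iverson-no (incAt P i ≟C (1 ∷ P))
                                          (λ eq → ℕ.1+n≢n (sym (trans (sym (length-incAt P i)) (cong length eq)))))
                              (multiplicity-appendedCover-parts {incAt P i} P (length-incAt P i) (allOnes? P)))
                   (multiplicity-raisedCovers P i) ⟩
    1 ∎
    where open ≡-Reasoning

  multiplicity-upperCovers : ∀ Q P → multiplicity Q (upperCovers P) ≡ iverson (covers? Q P)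
  multiplicity-upperCovers Q P = by-cases (covers? Q P)
    where
    by-cases : (d : Dec (Covers Q P)) → multiplicity Q (upperCovers P) ≡ iverson d
    by-cases (yes Q⋗P) = multiplicity-cover Q⋗P
    by-cases (no Q⋗̸P)  = multiplicity-none (All.map (λ {R} R⋗P Q≡R → Q⋗̸P (subst (λ X → Covers X P) (sym Q≡R) R⋗P))
                                                     (upperCovers-sound P))

  filter-covers-comps : ∀ {m P} {A : Pred Composition _} (A? : Decidable A) → IsComposition m P →
    length (filter A? (filter (λ Q → covers? Q P) (comps (suc m)))) ≡ length (filter A? (upperCovers P))
  filter-covers-comps {m} {P} A? P-valid = begin
    length (filter A? (filter (λ Q → covers? Q P) (comps (suc m))))
      ≡⟨ length-filter≡∑ A? (filter (λ Q → covers? Q P) (comps (suc m))) ⟩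
    ∑ (filter (λ Q → covers? Q P) (comps (suc m))) (iverson ∘ A?)
      ≡⟨ ∑-filter (λ Q → covers? Q P) (comps (suc m)) _ ⟩
    ∑ (comps (suc m)) (λ Q → iverson (covers? Q P) * iverson (A? Q))
      ≡⟨ ∑-cong (comps (suc m)) multiplicity-in-covers ⟩
    ∑ (comps (suc m)) (λ Q → ∑ covers (λ R → iverson (Q ≟C R)))
      ≡⟨ ∑-swap (comps (suc m)) covers _ ⟩
    ∑ covers (λ R → ∑ (comps (suc m)) (λ Q → iverson (Q ≟C R)))
      ≡⟨ ∑-cong covers (λ R → ∑-cong (comps (suc m)) (λ Q → iverson-≟C-sym Q R)) ⟩
    ∑ covers (λ R → multiplicity R (comps (suc m)))
      ≡⟨ ∑-cong-All (All.filter⁺ A? (upperCovers-valid P-valid)) (multiplicity-comps (suc m)) ⟩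
    ∑ covers (λ _ → 1)
      ≡⟨ trans (∑-const covers 1) (ℕ.*-identityʳ _) ⟩
    length covers ∎
    where
    open ≡-Reasoning
    covers : List Composition
    covers = filter A? (upperCovers P)
    multiplicity-in-covers : ∀ Q → iverson (covers? Q P) * iverson (A? Q) ≡ multiplicity Q covers
    multiplicity-in-covers Q = begin
      iverson (covers? Q P) * iverson (A? Q)        ≡⟨ ℕ.*-comm (iverson (covers? Q P)) _ ⟩
      iverson (A? Q) * iverson (covers? Q P)        ≡⟨ cong (iverson (A? Q) *_) (sym (multiplicity-upperCovers Q P)) ⟩
      iverson (A? Q) * multiplicity Q (upperCovers P) ≡⟨ sym (multiplicity-filter A? Q (upperCovers P)) ⟩
      multiplicity Q covers                         ∎

  standardPaths-valid : ∀ m → All (IsComposition m ∘ head) (standardPaths m)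
  standardPaths-valid zero    = ([] , refl) ∷ []
  standardPaths-valid (suc m) =
    All.concat⁺ (All.map⁺ (All.universal (λ _ → All.map⁺ (All.filter⁺ _ (comps-valid (suc m)))) (standardPaths m)))

  pathsTo : ∀ {A : Pred Composition _} → Decidable A → ℕ → ℕ
  pathsTo A? m = ∑ (standardPaths m) (iverson ∘ A? ∘ head)

  pathsTo-suc : ∀ {A : Pred Composition _} (A? : Decidable A) m →
    pathsTo A? (suc m) ≡ ∑ (standardPaths m) (λ p → length (filter A? (upperCovers (head p))))
  pathsTo-suc A? m =
    trans (∑-concatMap _ (standardPaths m) (iverson ∘ A? ∘ head))
          (∑-cong-All (standardPaths-valid m) λ {p} p-valid → begin
            ∑ (map (Vec._∷ p) (extensions p)) (iverson ∘ A? ∘ head) ≡⟨ ∑-map (Vec._∷ p) (extensions p) _ ⟩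
            ∑ (extensions p) (iverson ∘ A?)                        ≡⟨ length-filter≡∑ A? (extensions p) ⟨
            length (filter A? (extensions p))                      ≡⟨ filter-covers-comps A? p-valid ⟩
            length (filter A? (upperCovers (head p)))              ∎)
    where
    open ≡-Reasoning
    extensions : ∀ {n} → Vec Composition (suc n) → List Composition
    extensions {n} p = filter (λ Q → covers? Q (head p)) (comps (suc n))

  hasParts? : ∀ k → Decidable (λ (P : Composition) → length P ≡ k)
  hasParts? k P = length P ≟ k

  parts-upperCovers : ∀ P K →
    length (filter (hasParts? K) (upperCovers P)) + iverson (allOnes? P) * iverson (suc (length P) ≟ K)
      ≡ iverson (length P ≟ K) * length P + 2 * iverson (suc (length P) ≟ K)
  parts-upperCovers P K = begin
    length (filter (hasParts? K) (upperCovers P)) + ones * i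
      ≡⟨ cong (_+ ones * i) (length-filter≡∑ (hasParts? K) (upperCovers P)) ⟩
    i + ∑ (appendedCover P (allOnes? P) ++ raisedCovers P) w + ones * i
      ≡⟨ cong (λ z → i + z + ones * i) (∑-++ (appendedCover P (allOnes? P)) (raisedCovers P) w) ⟩
    i + (∑ (appendedCover P (allOnes? P)) w + ∑ (raisedCovers P) w) + ones * i
      ≡⟨ regroup i _ _ (ones * i) ⟩
    i + (∑ (appendedCover P (allOnes? P)) w + ones * i) + ∑ (raisedCovers P) w
      ≡⟨ cong₂ (λ x y → i + x + y) (appended-parts (allOnes? P)) raised-parts ⟩
    i + i + length P * c
      ≡⟨ regroup′ i (length P) c ⟩
    c * length P + 2 * i ∎
    where
    open ≡-Reasoning
    w : Composition → ℕ
    w = iverson ∘ hasParts? K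
    i c ones : ℕ
    i    = iverson (suc (length P) ≟ K)
    c    = iverson (length P ≟ K)
    ones = iverson (allOnes? P)
    appended-parts : (d : Dec (AllOnes P)) → ∑ (appendedCover P d) w + iverson d * i ≡ i
    appended-parts (yes _) = ℕ.+-identityʳ i
    appended-parts (no _)  =
      trans (ℕ.+-identityʳ _) (trans (ℕ.+-identityʳ _) (cong (λ n → iverson (n ≟ K)) (length-++[1] P)))
    raised-parts : ∑ (raisedCovers P) w ≡ length P * c
    raised-parts = begin
      ∑ (raisedCovers P) w          ≡⟨ ∑-cong-All (raisedCovers-parts P) (cong (λ n → iverson (n ≟ K))) ⟩
      ∑ (raisedCovers P) (λ _ → c)  ≡⟨ ∑-const (raisedCovers P) c ⟩
      length (raisedCovers P) * c   ≡⟨ cong (_* c) (length-raisedCovers P) ⟩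
      length P * c                  ∎
    regroup : ∀ i M S A → i + (M + S) + A ≡ i + (M + A) + S
    regroup = solve-∀
    regroup′ : ∀ i ℓ c → i + i + ℓ * c ≡ c * ℓ + 2 * i
    regroup′ = solve-∀

  allOnes-upperCovers : ∀ {P} → Positive P → length (filter allOnes? (upperCovers P)) ≡ iverson (allOnes? P)
  allOnes-upperCovers {P} P>0 = begin
    length (filter allOnes? (upperCovers P))
      ≡⟨ length-filter≡∑ allOnes? (upperCovers P) ⟩
    iverson (allOnes? P) + ∑ (appendedCover P (allOnes? P) ++ raisedCovers P) w
      ≡⟨ cong (iverson (allOnes? P) +_) (∑-++ (appendedCover P (allOnes? P)) (raisedCovers P) w) ⟩
    iverson (allOnes? P) + (∑ (appendedCover P (allOnes? P)) w + ∑ (raisedCovers P) w)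
      ≡⟨ cong (iverson (allOnes? P) +_) (cong₂ _+_ (appended-ones (allOnes? P)) raised-ones) ⟩
    iverson (allOnes? P) + 0
      ≡⟨ ℕ.+-identityʳ _ ⟩
    iverson (allOnes? P) ∎
    where
    open ≡-Reasoning
    w : Composition → ℕ
    w = iverson ∘ allOnes?
    appended-ones : (d : Dec (AllOnes P)) → ∑ (appendedCover P d) w ≡ 0
    appended-ones (yes _)    = refl
    appended-ones (no ¬ones) = cong (_+ 0) (iverson-no (allOnes? (P ++ [ 1 ])) (¬ones ∘ All.++⁻ˡ P))
    raised-ones : ∑ (raisedCovers P) w ≡ 0
    raised-ones = trans (∑-cong-All (raisedCovers-notAllOnes P>0) (iverson-no (allOnes? _))) (∑-zero (raisedCovers P))

  pathsTo-allOnes : ∀ m → pathsTo allOnes? m ≡ 1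
  pathsTo-allOnes zero    = refl
  pathsTo-allOnes (suc m) =
    trans (pathsTo-suc allOnes? m)
          (trans (∑-cong-All (standardPaths-valid m) (allOnes-upperCovers ∘ proj₁)) (pathsTo-allOnes m))

  weight-AllOnes : ∀ {P} → AllOnes P → weight P ≡ length P
  weight-AllOnes []            = refl
  weight-AllOnes (refl ∷ ones) = cong suc (weight-AllOnes ones)

  iverson-weight-allOnes : ∀ {m P} k → IsComposition m P →
    iverson (m ≟ k) * iverson (allOnes? P) ≡ iverson (allOnes? P) * iverson (length P ≟ k)
  iverson-weight-allOnes {m} {P} k (_ , w) = by-cases (allOnes? P)
    where
    by-cases : (d : Dec (AllOnes P)) → iverson (m ≟ k) * iverson d ≡ iverson d * iverson (length P ≟ k)
    by-cases (no _)     = ℕ.*-zeroʳ (iverson (m ≟ k))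
    by-cases (yes ones) = begin
      iverson (m ≟ k) * 1          ≡⟨ ℕ.*-identityʳ _ ⟩
      iverson (m ≟ k)              ≡⟨ cong (λ n → iverson (n ≟ k)) (trans (sym w) (weight-AllOnes ones)) ⟩
      iverson (length P ≟ k)       ≡⟨ ℕ.*-identityˡ _ ⟨
      1 * iverson (length P ≟ k)   ∎
      where open ≡-Reasoning

  a≡pathsTo : ∀ m k → a m k ≡ pathsTo (hasParts? k) m
  a≡pathsTo m k = length-filter≡∑ (hasParts? k ∘ head) (standardPaths m)

  a-noParts : ∀ m → a m 0 ≡ iverson (m ≟ 0)
  a-noParts zero    = refl
  a-noParts (suc m) =
    cong length (List.filter-none (hasParts? 0 ∘ head) (All.map nonempty (standardPaths-valid (suc m))))
    where
    nonempty : ∀ {Q} → IsComposition (suc m) Q → length Q ≢ 0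
    nonempty {[]}    (_ , ())
    nonempty {_ ∷ _} _ ()

  a-rec : ∀ m k → a (suc m) (suc k) + iverson (m ≟ k) ≡ suc k * a m (suc k) + 2 * a m k
  a-rec m k = begin
    a (suc m) K + δ
      ≡⟨ cong₂ _+_ (a≡pathsTo (suc m) K) (sym (trans (cong (δ *_) (pathsTo-allOnes m)) (ℕ.*-identityʳ δ))) ⟩
    pathsTo (hasParts? K) (suc m) + δ * pathsTo allOnes? m
      ≡⟨ cong₂ _+_ (pathsTo-suc (hasParts? K) m) (sym (∑-*ˡ paths δ _)) ⟩
    ∑ paths (λ p → covers-with-K-parts (head p)) + ∑ paths (λ p → δ * iverson (allOnes? (head p)))
      ≡⟨ ∑-+ paths _ _ ⟨
    ∑ paths (λ p → covers-with-K-parts (head p) + δ * iverson (allOnes? (head p)))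
      ≡⟨ ∑-cong-All (standardPaths-valid m) per-path ⟩
    ∑ paths (λ p → K * iverson (length (head p) ≟ K) + 2 * iverson (length (head p) ≟ k))
      ≡⟨ ∑-+ paths _ _ ⟩
    ∑ paths (λ p → K * iverson (length (head p) ≟ K)) + ∑ paths (λ p → 2 * iverson (length (head p) ≟ k))
      ≡⟨ cong₂ _+_ (∑-*ˡ paths K _) (∑-*ˡ paths 2 _) ⟩
    K * pathsTo (hasParts? K) m + 2 * pathsTo (hasParts? k) m
      ≡⟨ cong₂ (λ x y → K * x + 2 * y) (a≡pathsTo m K) (a≡pathsTo m k) ⟨
    K * a m K + 2 * a m k ∎
    where
    open ≡-Reasoning
    K δ : ℕ
    K = suc k
    δ = iverson (m ≟ k)
    paths = standardPaths m
    covers-with-K-parts : Composition → ℕ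
    covers-with-K-parts P = length (filter (hasParts? K) (upperCovers P))
    per-path : ∀ {P} → IsComposition m P →
      covers-with-K-parts P + δ * iverson (allOnes? P) ≡ K * iverson (length P ≟ K) + 2 * iverson (length P ≟ k)
    per-path {P} P-valid = begin
      covers-with-K-parts P + δ * iverson (allOnes? P)
        ≡⟨ cong (covers-with-K-parts P +_) (iverson-weight-allOnes k P-valid) ⟩
      covers-with-K-parts P + iverson (allOnes? P) * iverson (length P ≟ k)
        ≡⟨ parts-upperCovers P K ⟩
      iverson (length P ≟ K) * length P + 2 * iverson (length P ≟ k)
        ≡⟨ cong (_+ 2 * iverson (length P ≟ k)) (iverson-≡-* (length P) K (length P ≟ K)) ⟩
      K * iverson (length P ≟ K) + 2 * iverson (length P ≟ k) ∎

open Numerator using (L̃; L̃-degree; eval-L̃; mulSeries-denom-column)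
open Counting using (a-noParts; a-rec)
open import Data.Integer using (+_)

mainTheorem3 : (k : ℕ) → 1 ≤ k →
    Σ Poly λ L̃ →
      HasDegree L̃ (k ∸ 1)
      × eval L̃ (+ 1) ≡ + (2 ^ (k ∸ 1))
      × ((n : ℕ) → mulSeries (denom k) (λ m → + a m k) n ≡ coeff (shiftP k L̃) n)
mainTheorem3 (suc j) _ =
  L̃ (suc j) , L̃-degree j , eval-L̃ (suc j) , mulSeries-denom-column a a-noParts (λ _ → refl) a-rec (suc j)
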